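{- Let $\Delta$ be a pure $d$-dimensional vertex decomposable simplicial complex on a finite ground set $V$. Then either $\Delta$ is full over $V$, or there exists a linear order on $V$ such that, if $F$ is the reverse-lexicographically smallest $(d+1)$-subset of $V$ with $F \notin \Delta$, then the simplicial complex generated by $\Delta \cup \{F\}$ is vertex decomposable.
   Context: A simplicial complex $\Delta$ on a finite ground set $V$ is a collection of subsets of $V$ closed under taking subsets; elements $v\in V$ with $\{v\}\in\Delta$ are vertices, other elements of $V$ are loops. The void complex $\emptyset$ and the empty complex $\{\emptyset\}$ are simplicial complexes. Facets are inclusion-maximal faces; $\Delta$ is pure if all facets have the same cardinality; the dimension is the maximal facet cardinality minus one. The complex generated by a collection of sets is the smallest simplicial complex containing it. A simplex is a complex of the form $2^W$ (all subsets of a finite set $W$), including $\emptyset$ and $\{\emptyset\}$. For a face $F$: $\mathrm{lk}_\Delta(F)=\{G\in\Delta: G\cap F=\emptyset,\ G\cup F\in\Delta\}$ and $\mathrm{del}_\Delta(F)=\{G\in\Delta: F\not\subseteq G\}$, both with ground set $V\setminus F$. $\Delta$ is vertex decomposable if it is a simplex, or it has a vertex $v$ such that $\mathrm{del}_\Delta(v)$ and $\mathrm{lk}_\Delta(v)$ are vertex decomposable and every facet of $\mathrm{del}_\Delta(v)$ is a facet of $\Delta$. A $d$-dimensional complex is full over $V$ if it contains all $(d+1)$-subsets of $V$. For a linearly ordered $V$, $\{v_1<\dots<v_k\}$ is revlex smaller than $\{w_1<\dots<w_k\}$ if for the largest $j$ with $v_j\neq w_j$ we have $v_j<w_j$. 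-}

module Defs where

open import Data.Nat using (ℕ; suc; _<_)
open import Data.Fin using (Fin; toℕ)
open import Data.Fin.Subset using (Subset; _∈_; _∉_; _⊆_; _∪_; _-_; ⁅_⁆; ∣_∣; ⊤)
open import Data.Fin.Subset.Properties using (_∈?_)
open import Data.Fin.Permutation using (Permutation′; _⟨$⟩ˡ_)
open import Data.List using (List; []; _∷_; filter; map; reverse)
open import Data.List.Base using (allFin)
open import Data.Product using (Σ; _×_; ∃)
open import Data.Sum using (_⊎_)
open import Data.Empty using (⊥)
open import Relation.Nullary using (¬_)
open import Relation.Binary.PropositionalEquality using (_≡_)
open import Function.Bundles using (_⇔_)

-- The ground set is a subset W of Fin n; a complex on W is a predicate on
-- subsets of Fin n (the faces), all faces contained in W.
Complex : ℕ → Set₁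
Complex n = Subset n → Set

IsComplex : {n : ℕ} → Subset n → Complex n → Set
IsComplex W Δ = (∀ G → Δ G → G ⊆ W) × (∀ G H → Δ G → H ⊆ G → Δ H)

Facet : {n : ℕ} → Complex n → Subset n → Set
Facet Δ G = Δ G × (∀ H → Δ H → G ⊆ H → H ≡ G)

PureOfDim : {n : ℕ} → ℕ → Complex n → Set
PureOfDim d Δ = (∃ λ G → Facet Δ G) × (∀ G → Facet Δ G → ∣ G ∣ ≡ suc d)

IsSimplex : {n : ℕ} → Subset n → Complex n → Set
IsSimplex {n} W Δ = (∀ G → ¬ Δ G) ⊎ (Σ (Subset n) λ U → U ⊆ W × (∀ G → Δ G ⇔ G ⊆ U))

lk : {n : ℕ} → Complex n → Fin n → Complex n
lk Δ v G = v ∉ G × Δ (G ∪ ⁅ v ⁆)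

del : {n : ℕ} → Complex n → Fin n → Complex n
del Δ v G = Δ G × v ∉ G

data VertexDecomposable {n : ℕ} : Subset n → Complex n → Set₁ where
  simplex : ∀ {W Δ} → IsSimplex W Δ → VertexDecomposable W Δ
  shedding : ∀ {W Δ} (v : Fin n) → v ∈ W → Δ ⁅ v ⁆ →
    VertexDecomposable (W - v) (del Δ v) →
    VertexDecomposable (W - v) (lk Δ v) →
    (∀ G → Facet (del Δ v) G → Facet Δ G) →
    VertexDecomposable W Δ

Full : {n : ℕ} → ℕ → Complex n → Set
Full {n} d Δ = ∀ (G : Subset n) → ∣ G ∣ ≡ suc d → Δ G

addFace : {n : ℕ} → Complex n → Subset n → Complex n
addFace Δ F G = Δ G ⊎ G ⊆ F

-- A linear order on Fin n is given by a permutation π : v ↦ rank of v.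
-- rankList π A = the ranks of the elements of A, in increasing order
-- (i.e. the list v₁ < … < v_k of A in the order π, encoded by ranks).
rankList : {n : ℕ} → Permutation′ n → Subset n → List ℕ
rankList {n} π A = map toℕ (filter (λ r → (π ⟨$⟩ˡ r) ∈? A) (allFin n))

data LexLt : List ℕ → List ℕ → Set where
  here  : ∀ {x y xs ys} → x < y → LexLt (x ∷ xs) (y ∷ ys)
  there : ∀ {x xs ys} → LexLt xs ys → LexLt (x ∷ xs) (x ∷ ys)

-- revlex: for the largest j with v_j ≠ w_j, v_j < w_j; i.e. lex comparison
-- of the sorted lists read from the top down
RevlexLt : {n : ℕ} → Permutation′ n → Subset n → Subset n → Set
RevlexLt π A B = LexLt (reverse (rankList π A)) (reverse (rankList π B))

module Submission where

-- Induct along the vertex decomposition, fixing the order from the top down.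
-- If the shedding vertex v leaves some (d+1)-set of W - v missing from del v, rank v last:
-- the revlex-least missing set F then avoids v and is the least missing set of del v, so
-- del (Δ ∪ F) v = del v ∪ F is vertex decomposable by induction, while the link is
-- unchanged.  Otherwise del v is full, every missing set F contains v and F - v is a face;
-- ranking v last makes F - v the least missing set of lk v, so lk (Δ ∪ F) v = lk v ∪ (F - v)
-- is vertex decomposable by induction, while the deletion is unchanged.  In both cases F
-- has the size of the facets, so v stays a shedding vertex.  A simplex 2^U on W is handled
-- by ranking vertices z ∉ U last until del z is full; then F - z ⊆ U and Δ ∪ F sheds z
-- with deletion 2^U and link 2^(F - z).

open import Defs
open import Data.Nat using (ℕ; zero; suc; _≤_; _<_; _>_)
open import Data.Nat.Properties as ℕ
  using (<⇒≱; <⇒≤; ≤∧≢⇒<; <-irrefl; <-asym; <-trans; ≤-trans; ≤-reflexive; ≤-pred; suc-injective)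
open import Data.Fin using (Fin; zero; suc; toℕ; fromℕ; punchIn; punchOut)
open import Data.Fin.Properties as Fin
  using (toℕ-injective; toℕ<n; toℕ-fromℕ; punchIn-punchOut; punchIn-cancel-≤; punchOut-cancel-≤)
open import Data.Fin.Subset
open import Data.Fin.Subset.Properties
open import Data.Fin.Subset.Induction using (Acc; acc; ⊂-wellFounded; ⊃-wellFounded)
open import Data.Fin.Permutation
  using (Permutation′; _⟨$⟩ˡ_; _⟨$⟩ʳ_; inverseˡ; inverseʳ; insert; id; _∘ₚ_; insert-punchIn)
open import Data.Vec.Base using (_∷_; here; there)
open import Data.List using ([]; _∷_; reverse; allFin)
open import Data.List.Properties using (unfold-reverse)
open import Data.List.Relation.Unary.All as All using ([]; _∷_)
open import Data.List.Relation.Unary.AllPairs using (AllPairs; []; _∷_)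
import Data.List.Relation.Unary.AllPairs.Properties as AllPairs
open import Data.List.Relation.Unary.Any using (here; there)
import Data.List.Relation.Unary.Any.Properties as Any
import Data.List.Membership.Propositional as List
open import Data.List.Membership.Propositional.Properties
  using (∈-map⁺; ∈-map⁻; ∈-filter⁺; ∈-filter⁻; ∈-allFin)
open import Data.Product using (Σ; ∃; _×_; _,_; proj₁; proj₂)
open import Data.Sum using (_⊎_; inj₁; inj₂)
open import Data.Empty using (⊥-elim)
open import Function.Base using (_∘_; flip)
open import Function.Bundles using (Injection; mk⇔; Equivalence)
open import Function.Properties.Inverse using (↔⇒↣)
open import Relation.Binary.Core using (Rel)
open import Relation.Binary.PropositionalEquality
  using (_≡_; _≢_; refl; sym; trans; cong; subst; subst₂; module ≡-Reasoning)
open import Relation.Nullary using (¬_; Dec; yes; no; ¬?; _×-dec_)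
open import Relation.Nullary.Decidable using (map′; decidable-stable)
open import Relation.Unary using (Decidable; _≐_)
open import Relation.Unary.Properties using (≐-sym; ≐-trans)

open Equivalence using (to; from)

private
  variable
    n : ℕ
    x y v : Fin n
    p q W F G : Subset n
    Δ Δ′ : Complex n

-- Subsets

x∉p-x : ∀ (p : Subset n) x → x ∉ p - x
x∉p-x (_ ∷ p) zero ()
x∉p-x (_ ∷ p) (suc x) (there x∈) = x∉p-x p x x∈

x∈p-y⇒x∈p : x ∈ p - y → x ∈ p
x∈p-y⇒x∈p {p = p} {y = y} = p─q⊆p p ⁅ y ⁆

x∈p-y⇒x≢y : x ∈ p - y → x ≢ y
x∈p-y⇒x≢y {p = p} x∈ refl = x∉p-x p _ x∈

x∈p∪⁅y⁆⁻ : x ∈ p ∪ ⁅ y ⁆ → x ∈ p ⊎ x ≡ y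
x∈p∪⁅y⁆⁻ {x = x} {p = p} {y = y} x∈ with x∈p∪q⁻ p ⁅ y ⁆ x∈
... | inj₁ x∈p = inj₁ x∈p
... | inj₂ x∈⁅y⁆ = inj₂ (x∈⁅y⁆⇒x≡y y x∈⁅y⁆)

x∈p∪⁅x⁆ : x ∈ p ∪ ⁅ x ⁆
x∈p∪⁅x⁆ {x = x} = x∈p∪q⁺ (inj₂ (x∈⁅x⁆ x))

p⊆q∧x∈q⇒p∪⁅x⁆⊆q : p ⊆ q → x ∈ q → p ∪ ⁅ x ⁆ ⊆ q
p⊆q∧x∈q⇒p∪⁅x⁆⊆q p⊆q x∈q y∈ with x∈p∪⁅y⁆⁻ y∈
... | inj₁ y∈p = p⊆q y∈p
... | inj₂ refl = x∈q

p⊆q∧x∉p⇒p⊆q-x : p ⊆ q → x ∉ p → p ⊆ q - x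
p⊆q∧x∉p⇒p⊆q-x p⊆q x∉p y∈p = x∈p∧x≢y⇒x∈p-y (p⊆q y∈p) λ { refl → x∉p y∈p }

p⊆q-x⇒x∉p : p ⊆ q - x → x ∉ p
p⊆q-x⇒x∉p {q = q} {x = x} p⊆q-x x∈p = x∉p-x q x (p⊆q-x x∈p)

p⊆q⇒p-x⊆q-x : p ⊆ q → p - x ⊆ q - x
p⊆q⇒p-x⊆q-x p⊆q y∈ = x∈p∧x≢y⇒x∈p-y (p⊆q (x∈p-y⇒x∈p y∈)) (x∈p-y⇒x≢y y∈)

[p-x]∪⁅x⁆≡p : x ∈ p → (p - x) ∪ ⁅ x ⁆ ≡ p
[p-x]∪⁅x⁆≡p {x = x} {p = p} x∈p = ⊆-antisym (p⊆q∧x∈q⇒p∪⁅x⁆⊆q x∈p-y⇒x∈p x∈p) ⊆∪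
  where
  ⊆∪ : p ⊆ (p - x) ∪ ⁅ x ⁆
  ⊆∪ {y} y∈p with y Fin.≟ x
  ... | yes refl = x∈p∪⁅x⁆
  ... | no y≢x = x∈p∪q⁺ (inj₁ (x∈p∧x≢y⇒x∈p-y y∈p y≢x))

[p∪⁅x⁆]-x≡p : x ∉ p → (p ∪ ⁅ x ⁆) - x ≡ p
[p∪⁅x⁆]-x≡p {x = x} {p = p} x∉p =
  ⊆-antisym ⊆p (p⊆q∧x∉p⇒p⊆q-x (p⊆p∪q _) x∉p)
  where
  ⊆p : (p ∪ ⁅ x ⁆) - x ⊆ p
  ⊆p y∈ with x∈p∪⁅y⁆⁻ (x∈p-y⇒x∈p y∈)
  ... | inj₁ y∈p = y∈p
  ... | inj₂ refl = ⊥-elim (x∈p-y⇒x≢y y∈ refl)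

∣p∪⁅x⁆∣≡1+∣p∣ : x ∉ p → ∣ p ∪ ⁅ x ⁆ ∣ ≡ suc ∣ p ∣
∣p∪⁅x⁆∣≡1+∣p∣ {x = zero}  {p = outside ∷ p} x∉p rewrite ∪-identityʳ p = refl
∣p∪⁅x⁆∣≡1+∣p∣ {x = zero}  {p = inside ∷ p}  x∉p = ⊥-elim (x∉p here)
∣p∪⁅x⁆∣≡1+∣p∣ {x = suc x} {p = outside ∷ p} x∉p = ∣p∪⁅x⁆∣≡1+∣p∣ (x∉p ∘ there)
∣p∪⁅x⁆∣≡1+∣p∣ {x = suc x} {p = inside ∷ p}  x∉p =
  cong suc (∣p∪⁅x⁆∣≡1+∣p∣ (x∉p ∘ there))

1+∣p-x∣≡∣p∣ : x ∈ p → suc ∣ p - x ∣ ≡ ∣ p ∣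
1+∣p-x∣≡∣p∣ {x = x} {p = p} x∈p =
  trans (sym (∣p∪⁅x⁆∣≡1+∣p∣ (x∉p-x p x))) (cong ∣_∣ ([p-x]∪⁅x⁆≡p x∈p))

∃∈q∖p⊎q⊆p : ∀ (p q : Subset n) → (∃ λ x → x ∈ q × x ∉ p) ⊎ q ⊆ p
∃∈q∖p⊎q⊆p p q with Fin.any? (λ x → (x ∈? q) ×-dec ¬? (x ∈? p))
... | yes witness = inj₁ witness
... | no none = inj₂ λ {x} x∈q → decidable-stable (x ∈? p) λ x∉p → none (x , x∈q , x∉p)

p⊆q∧∣q∣≤∣p∣⇒p≡q : p ⊆ q → ∣ q ∣ ≤ ∣ p ∣ → p ≡ q
p⊆q∧∣q∣≤∣p∣⇒p≡q {p = p} {q = q} p⊆q ∣q∣≤∣p∣ with ∃∈q∖p⊎q⊆p p q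
... | inj₁ x∈q∖p = ⊥-elim (<⇒≱ (p⊂q⇒∣p∣<∣q∣ (p⊆q , x∈q∖p)) ∣q∣≤∣p∣)
... | inj₂ q⊆p = ⊆-antisym p⊆q q⊆p

∣p∣<∣q∣⇒∃∈q∖p : ∣ p ∣ < ∣ q ∣ → ∃ λ x → x ∈ q × x ∉ p
∣p∣<∣q∣⇒∃∈q∖p {p = p} {q = q} ∣p∣<∣q∣ with ∃∈q∖p⊎q⊆p p q
... | inj₁ x∈q∖p = x∈q∖p
... | inj₂ q⊆p = ⊥-elim (<⇒≱ ∣p∣<∣q∣ (p⊆q⇒∣p∣≤∣q∣ q⊆p))

-- Linear orders and revlex

⟨$⟩ʳ-injective : ∀ (π : Permutation′ n) → π ⟨$⟩ʳ x ≡ π ⟨$⟩ʳ y → x ≡ y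
⟨$⟩ʳ-injective π = Injection.injective (↔⇒↣ π)

rank : Permutation′ n → Fin n → ℕ
rank π x = toℕ (π ⟨$⟩ʳ x)

rank-injective : ∀ (π : Permutation′ n) → rank π x ≡ rank π y → x ≡ y
rank-injective π = ⟨$⟩ʳ-injective π ∘ toℕ-injective

-- π with v re-ranked last, the other elements keeping their relative order.
moveToTop : Permutation′ n → Fin n → Permutation′ n
moveToTop {suc m} π v = π ∘ₚ insert (π ⟨$⟩ʳ v) (fromℕ m) id

insert-id-≡ : ∀ {m} (i j : Fin (suc m)) → insert i j id ⟨$⟩ʳ i ≡ j
insert-id-≡ i j with i Fin.≟ i
... | yes _ = refl
... | no i≢i = ⊥-elim (i≢i refl)

insert-id-≢ : ∀ {m} {i k : Fin (suc m)} (j : Fin (suc m)) (i≢k : i ≢ k) →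
  insert i j id ⟨$⟩ʳ k ≡ punchIn j (punchOut i≢k)
insert-id-≢ {i = i} j i≢k =
  trans (cong (insert i j id ⟨$⟩ʳ_) (sym (punchIn-punchOut i≢k)))
        (insert-punchIn i j id (punchOut i≢k))

moveToTop-top : ∀ (π : Permutation′ n) → x ≢ v → rank (moveToTop π v) x < rank (moveToTop π v) v
moveToTop-top {n = suc m} {x = x} {v = v} π x≢v = subst (rank π′ x <_) rank-v rank-x<m
  where
  π′ = moveToTop π v
  rank-v : m ≡ rank π′ v
  rank-v = trans (sym (toℕ-fromℕ m)) (cong toℕ (sym (insert-id-≡ (π ⟨$⟩ʳ v) (fromℕ m))))
  rank-x<m : rank π′ x < m
  rank-x<m = ≤∧≢⇒< (≤-pred (toℕ<n (π′ ⟨$⟩ʳ x)))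
                    λ eq → x≢v (rank-injective π′ (trans eq rank-v))

moveToTop-reflects-< : ∀ (π : Permutation′ n) → x ≢ v → y ≢ v →
  rank (moveToTop π v) x < rank (moveToTop π v) y → rank π x < rank π y
moveToTop-reflects-< {n = suc m} {x = x} {v = v} {y = y} π x≢v y≢v lt = ≤∧≢⇒< ≤-reflected x≢y
  where
  v≢x : π ⟨$⟩ʳ v ≢ π ⟨$⟩ʳ x
  v≢x = x≢v ∘ sym ∘ ⟨$⟩ʳ-injective π
  v≢y : π ⟨$⟩ʳ v ≢ π ⟨$⟩ʳ y
  v≢y = y≢v ∘ sym ∘ ⟨$⟩ʳ-injective π
  ≤-reflected : rank π x ≤ rank π y
  ≤-reflected = punchOut-cancel-≤ v≢x v≢y (punchIn-cancel-≤ (fromℕ m) _ _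
    (subst₂ (λ a b → toℕ a ≤ toℕ b)
            (insert-id-≢ (fromℕ m) v≢x) (insert-id-≢ (fromℕ m) v≢y) (<⇒≤ lt)))
  x≢y : rank π x ≢ rank π y
  x≢y eq with rank-injective π eq
  ... | refl = <-irrefl refl lt

-- Set form of revlex precedence: the largest element of A △ B lies in B.
Dominated : Permutation′ n → Subset n → Subset n → Set
Dominated π A B = ∃ λ e → e ∈ B × e ∉ A × (∀ y → y ∈ A → y ∉ B → rank π y < rank π e)

dominated-moveToTop⁻ : ∀ (π : Permutation′ n) {A B} → v ∉ A → v ∉ B →
  Dominated (moveToTop π v) A B → Dominated π A B
dominated-moveToTop⁻ π v∉A v∉B (e , e∈B , e∉A , below) =
  e , e∈B , e∉A , λ y y∈A y∉B →
    moveToTop-reflects-< π (λ { refl → v∉A y∈A }) (λ { refl → v∉B e∈B }) (below y y∈A y∉B)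

moveToTop-¬dominated : ∀ (π : Permutation′ n) {A B} → v ∈ A → v ∉ B →
  ¬ Dominated (moveToTop π v) A B
moveToTop-¬dominated π v∈A v∉B (e , e∈B , _ , below) =
  <-asym (below _ v∈A v∉B) (moveToTop-top π λ { refl → v∉B e∈B })

dominated-remove : ∀ (π : Permutation′ n) {A B} → v ∈ A → Dominated π A B → Dominated π (A - v) (B - v)
dominated-remove π v∈A (e , e∈B , e∉A , below) =
  e , x∈p∧x≢y⇒x∈p-y e∈B (λ { refl → e∉A v∈A }) , e∉A ∘ x∈p-y⇒x∈p ,
  λ y y∈A-v y∉B-v → below y (x∈p-y⇒x∈p y∈A-v)
    (λ y∈B → y∉B-v (x∈p∧x≢y⇒x∈p-y y∈B (x∈p-y⇒x≢y y∈A-v)))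

AllPairs-reverse⁺ : ∀ {a ℓ} {A : Set a} {R : Rel A ℓ} {xs} →
  AllPairs R xs → AllPairs (flip R) (reverse xs)
AllPairs-reverse⁺ {xs = []} [] = []
AllPairs-reverse⁺ {xs = x ∷ xs} (x~xs ∷ pairs) rewrite unfold-reverse x xs =
  AllPairs.++⁺ (AllPairs-reverse⁺ pairs) ([] ∷ [])
    (All.tabulate λ y∈ → All.lookup x~xs (Any.reverse⁻ y∈) ∷ [])

lexLt⇒dominating : ∀ {xs ys} → AllPairs _>_ xs → AllPairs _>_ ys → LexLt xs ys →
  ∃ λ m → m List.∈ ys × m List.∉ xs × (∀ z → z List.∈ xs → z List.∉ ys → z < m)
lexLt⇒dominating {x ∷ xs} {y ∷ ys} (x>xs ∷ _) _ (here x<y) = y , here refl , y∉ , below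
  where
  y∉ : y List.∉ x ∷ xs
  y∉ (here refl) = <-irrefl refl x<y
  y∉ (there y∈xs) = <-asym x<y (All.lookup x>xs y∈xs)
  below : ∀ z → z List.∈ x ∷ xs → z List.∉ y ∷ ys → z < y
  below z (here refl) _ = x<y
  below z (there z∈xs) _ = <-trans (All.lookup x>xs z∈xs) x<y
lexLt⇒dominating {x ∷ xs} {x ∷ ys} (_ ∷ xs↓) (x>ys ∷ ys↓) (there lt)
  with m , m∈ys , m∉xs , below ← lexLt⇒dominating xs↓ ys↓ lt = m , there m∈ys , m∉ , below′
  where
  m∉ : m List.∉ x ∷ xs
  m∉ (here refl) = <-irrefl refl (All.lookup x>ys m∈ys)
  m∉ (there m∈xs) = m∉xs m∈xs
  below′ : ∀ z → z List.∈ x ∷ xs → z List.∉ x ∷ ys → z < m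
  below′ z (here refl) z∉ = ⊥-elim (z∉ (here refl))
  below′ z (there z∈xs) z∉ = below z z∈xs (z∉ ∘ there)

module _ (π : Permutation′ n) where

  private
    inRank? : ∀ A (r : Fin n) → Dec ((π ⟨$⟩ˡ r) ∈ A)
    inRank? A r = (π ⟨$⟩ˡ r) ∈? A

  rankList-ascending : ∀ A → AllPairs _<_ (rankList π A)
  rankList-ascending A =
    AllPairs.map⁺ (AllPairs.filter⁺ (inRank? A) (AllPairs.tabulate⁺-< (λ i<j → i<j)))

  revRankList-descending : ∀ A → AllPairs _>_ (reverse (rankList π A))
  revRankList-descending A = AllPairs-reverse⁺ (rankList-ascending A)

  rank∈rankList : ∀ {A} → y ∈ A → rank π y List.∈ rankList π A
  rank∈rankList {A = A} y∈A =
    ∈-map⁺ toℕ (∈-filter⁺ (inRank? A) (∈-allFin _) (subst (_∈ A) (sym (inverseˡ π)) y∈A))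

  ∈rankList⁻ : ∀ {A m} → m List.∈ rankList π A → ∃ λ y → y ∈ A × m ≡ rank π y
  ∈rankList⁻ {A} m∈ with r , r∈ , refl ← ∈-map⁻ toℕ m∈ =
    π ⟨$⟩ˡ r , proj₂ (∈-filter⁻ (inRank? A) {xs = allFin n} r∈) , cong toℕ (sym (inverseʳ π))

  rank∈rankList⁻ : ∀ {A} → rank π y List.∈ rankList π A → y ∈ A
  rank∈rankList⁻ y∈ with y′ , y′∈A , eq ← ∈rankList⁻ y∈ =
    subst (_∈ _) (sym (rank-injective π eq)) y′∈A

  revlex⇒dominated : ∀ {A B} → RevlexLt π A B → Dominated π A B
  revlex⇒dominated {A} {B} lt
    with m , m∈ , m∉ , below ← lexLt⇒dominating (revRankList-descending A) (revRankList-descending B) lt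
    with e , e∈B , refl ← ∈rankList⁻ (Any.reverse⁻ m∈) =
    e , e∈B , m∉ ∘ Any.reverse⁺ ∘ rank∈rankList , λ y y∈A y∉B →
      below (rank π y) (Any.reverse⁺ (rank∈rankList y∈A)) (y∉B ∘ rank∈rankList⁻ ∘ Any.reverse⁻)

-- Complexes

Closed : Complex n → Set
Closed Δ = ∀ G H → Δ G → H ⊆ G → Δ H

Simplex : Subset n → Complex n
Simplex U G = G ⊆ U

Pure : ℕ → Complex n → Set
Pure k Δ = (∃ λ G → Facet Δ G) × (∀ G → Facet Δ G → ∣ G ∣ ≡ k)

IsShedding : Complex n → Fin n → Set
IsShedding Δ v = ∀ G → Facet (del Δ v) G → Facet Δ G

del-closed : Closed Δ → Closed (del Δ v)
del-closed closed G H (ΔG , v∉G) H⊆G = closed G H ΔG H⊆G , v∉G ∘ H⊆G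

lk-closed : Closed Δ → Closed (lk Δ v)
lk-closed closed G H (v∉G , ΔG+v) H⊆G =
  v∉G ∘ H⊆G , closed _ _ ΔG+v (p⊆q∧x∈q⇒p∪⁅x⁆⊆q (p⊆p∪q _ ∘ H⊆G) x∈p∪⁅x⁆)

del-isComplex : IsComplex W Δ → IsComplex (W - v) (del Δ v)
del-isComplex (faces⊆W , closed) =
  (λ G (ΔG , v∉G) → p⊆q∧x∉p⇒p⊆q-x (faces⊆W G ΔG) v∉G) , del-closed closed

lk-isComplex : IsComplex W Δ → IsComplex (W - v) (lk Δ v)
lk-isComplex (faces⊆W , closed) =
  (λ G (v∉G , ΔG+v) → p⊆q∧x∉p⇒p⊆q-x (faces⊆W _ ΔG+v ∘ p⊆p∪q _) v∉G) , lk-closed closed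

del-resp-≐ : Δ ≐ Δ′ → del Δ v ≐ del Δ′ v
del-resp-≐ (Δ⊆Δ′ , Δ′⊆Δ) =
  (λ (ΔG , v∉G) → Δ⊆Δ′ ΔG , v∉G) , (λ (Δ′G , v∉G) → Δ′⊆Δ Δ′G , v∉G)

lk-resp-≐ : Δ ≐ Δ′ → lk Δ v ≐ lk Δ′ v
lk-resp-≐ (Δ⊆Δ′ , Δ′⊆Δ) =
  (λ (v∉G , ΔG+v) → v∉G , Δ⊆Δ′ ΔG+v) , (λ (v∉G , Δ′G+v) → v∉G , Δ′⊆Δ Δ′G+v)

Facet-resp-≐ : Δ ≐ Δ′ → Facet Δ G → Facet Δ′ G
Facet-resp-≐ (Δ⊆Δ′ , Δ′⊆Δ) (ΔG , maximal) =
  Δ⊆Δ′ ΔG , λ H Δ′H G⊆H → maximal H (Δ′⊆Δ Δ′H) G⊆H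

VD-resp-≐ : Δ ≐ Δ′ → VertexDecomposable W Δ → VertexDecomposable W Δ′
VD-resp-≐ (_ , Δ′⊆Δ) (simplex (inj₁ void)) = simplex (inj₁ λ G → void G ∘ Δ′⊆Δ)
VD-resp-≐ (Δ⊆Δ′ , Δ′⊆Δ) (simplex (inj₂ (U , U⊆W , Δ⇔U))) =
  simplex (inj₂ (U , U⊆W , λ G → mk⇔ (to (Δ⇔U G) ∘ Δ′⊆Δ) (Δ⊆Δ′ ∘ from (Δ⇔U G))))
VD-resp-≐ Δ≐Δ′ (shedding v v∈W Δv vdDel vdLk shedding-v) =
  shedding v v∈W (proj₁ Δ≐Δ′ Δv)
    (VD-resp-≐ (del-resp-≐ Δ≐Δ′) vdDel) (VD-resp-≐ (lk-resp-≐ Δ≐Δ′) vdLk)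
    λ G → Facet-resp-≐ Δ≐Δ′ ∘ shedding-v G ∘ Facet-resp-≐ (del-resp-≐ (≐-sym Δ≐Δ′))

VD-mono : ∀ {W′} → W ⊆ W′ → VertexDecomposable W Δ → VertexDecomposable W′ Δ
VD-mono W⊆W′ (simplex (inj₁ void)) = simplex (inj₁ void)
VD-mono W⊆W′ (simplex (inj₂ (U , U⊆W , Δ⇔U))) = simplex (inj₂ (U , W⊆W′ ∘ U⊆W , Δ⇔U))
VD-mono W⊆W′ (shedding v v∈W Δv vdDel vdLk shedding-v) =
  shedding v (W⊆W′ v∈W) Δv
    (VD-mono (p⊆q⇒p-x⊆q-x W⊆W′) vdDel) (VD-mono (p⊆q⇒p-x⊆q-x W⊆W′) vdLk) shedding-v

VD⇒decidable : VertexDecomposable W Δ → Decidable Δ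
VD⇒decidable (simplex (inj₁ void)) G = no (void G)
VD⇒decidable (simplex (inj₂ (U , _ , Δ⇔U))) G = map′ (from (Δ⇔U G)) (to (Δ⇔U G)) (G ⊆? U)
VD⇒decidable {Δ = Δ} (shedding v _ _ vdDel vdLk _) G with v ∈? G
... | yes v∈G = map′ (λ (_ , ΔG) → subst Δ ([p-x]∪⁅x⁆≡p v∈G) ΔG)
                     (λ ΔG → x∉p-x G v , subst Δ (sym ([p-x]∪⁅x⁆≡p v∈G)) ΔG)
                     (VD⇒decidable vdLk (G - v))
... | no v∉G = map′ proj₁ (_, v∉G) (VD⇒decidable vdDel G)

extendToFacet : Decidable Δ → Closed Δ → Δ G → ∃ λ H → G ⊆ H × Facet Δ H
extendToFacet {Δ = Δ} Δ? closed = extend (⊃-wellFounded _)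
  where
  extend : ∀ {G} → Acc _⊃_ G → Δ G → ∃ λ H → G ⊆ H × Facet Δ H
  extend {G} (acc larger) ΔG with Fin.any? (λ x → ¬? (x ∈? G) ×-dec Δ? (G ∪ ⁅ x ⁆))
  ... | yes (x , x∉G , ΔG+x)
    with H , G+x⊆H , facet ← extend (larger (p⊆p∪q _ , x , x∈p∪⁅x⁆ , x∉G)) ΔG+x =
    H , G+x⊆H ∘ p⊆p∪q _ , facet
  ... | no unextendable = G , ⊆-refl , ΔG , maximal
    where
    maximal : ∀ H → Δ H → G ⊆ H → H ≡ G
    maximal H ΔH G⊆H with ∃∈q∖p⊎q⊆p G H
    ... | inj₁ (x , x∈H , x∉G) =
      ⊥-elim (unextendable (x , x∉G , closed H _ ΔH (p⊆q∧x∈q⇒p∪⁅x⁆⊆q G⊆H x∈H)))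
    ... | inj₂ H⊆G = ⊆-antisym H⊆G G⊆H

face-bound : ∀ {k} → Decidable Δ → Closed Δ → Pure k Δ → Δ G → ∣ G ∣ ≤ k
face-bound Δ? closed (_ , size) ΔG with H , G⊆H , facet ← extendToFacet Δ? closed ΔG =
  ≤-trans (p⊆q⇒∣p∣≤∣q∣ G⊆H) (≤-reflexive (size H facet))

lk-facet⇒facet : Facet (lk Δ v) G → Facet Δ (G ∪ ⁅ v ⁆)
lk-facet⇒facet {Δ = Δ} {v = v} {G = G} ((v∉G , ΔG+v) , maximal) = ΔG+v , maximal′
  where
  maximal′ : ∀ K → Δ K → G ∪ ⁅ v ⁆ ⊆ K → K ≡ G ∪ ⁅ v ⁆
  maximal′ K ΔK G+v⊆K = begin
    K                 ≡⟨ sym ([p-x]∪⁅x⁆≡p v∈K) ⟩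
    (K - v) ∪ ⁅ v ⁆   ≡⟨ cong (_∪ ⁅ v ⁆) K-v≡G ⟩
    G ∪ ⁅ v ⁆         ∎
    where
    open ≡-Reasoning
    v∈K = G+v⊆K x∈p∪⁅x⁆
    K-v≡G : K - v ≡ G
    K-v≡G = maximal (K - v) (x∉p-x K v , subst Δ (sym ([p-x]∪⁅x⁆≡p v∈K)) ΔK)
                    (p⊆q∧x∉p⇒p⊆q-x (G+v⊆K ∘ p⊆p∪q _) v∉G)

del-pure : ∀ {k} → Decidable (del Δ v) → Closed Δ → Δ ⊥ → IsShedding Δ v →
  Pure k Δ → Pure k (del Δ v)
del-pure del? closed Δ∅ shedding-v (_ , size)
  with H , _ , facet ← extendToFacet del? (del-closed closed) (Δ∅ , ∉⊥) =
  (H , facet) , λ G facet′ → size G (shedding-v G facet′)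

∅∈lk : Closed Δ → Δ ⁅ v ⁆ → lk Δ v ⊥
∅∈lk {v = v} closed Δv = ∉⊥ , closed ⁅ v ⁆ _ Δv (p⊆q∧x∈q⇒p∪⁅x⁆⊆q ⊥⊆ (x∈⁅x⁆ v))

lk-pure : ∀ {k} → Decidable (lk Δ v) → Closed Δ → Δ ⁅ v ⁆ → Pure (suc k) Δ → Pure k (lk Δ v)
lk-pure lk? closed Δv (_ , size)
  with H , _ , facet ← extendToFacet lk? (lk-closed closed) (∅∈lk closed Δv) =
  (H , facet) , λ G facet′ →
    suc-injective (trans (sym (∣p∪⁅x⁆∣≡1+∣p∣ (proj₁ (proj₁ facet′))))
                         (size _ (lk-facet⇒facet facet′)))

facet-addFace⁺ : Facet Δ G → ∣ F ∣ ≤ ∣ G ∣ → Facet (addFace Δ F) G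
facet-addFace⁺ {Δ = Δ} {G = G} {F = F} (ΔG , maximal) ∣F∣≤∣G∣ = inj₁ ΔG , maximal′
  where
  maximal′ : ∀ H → addFace Δ F H → G ⊆ H → H ≡ G
  maximal′ H (inj₁ ΔH) G⊆H = maximal H ΔH G⊆H
  maximal′ H (inj₂ H⊆F) G⊆H =
    sym (p⊆q∧∣q∣≤∣p∣⇒p≡q G⊆H (≤-trans (p⊆q⇒∣p∣≤∣q∣ H⊆F) ∣F∣≤∣G∣))

facet-addFace-pure : ∀ {k} → Pure k Δ → ∣ F ∣ ≡ k → Facet Δ G → Facet (addFace Δ F) G
facet-addFace-pure (_ , size) ∣F∣ facet =
  facet-addFace⁺ facet (≤-reflexive (trans ∣F∣ (sym (size _ facet))))

facet-addFace-self : (∀ H → Δ H → ∣ H ∣ ≤ ∣ F ∣) → Facet (addFace Δ F) F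
facet-addFace-self {Δ = Δ} {F = F} bounded = inj₂ ⊆-refl , maximal
  where
  maximal : ∀ H → addFace Δ F H → F ⊆ H → H ≡ F
  maximal H (inj₁ ΔH) F⊆H = sym (p⊆q∧∣q∣≤∣p∣⇒p≡q F⊆H (bounded H ΔH))
  maximal H (inj₂ H⊆F) F⊆H = ⊆-antisym H⊆F F⊆H

facet-addFace⁻ : Facet (addFace Δ F) G → Facet Δ G ⊎ G ≡ F
facet-addFace⁻ (inj₁ ΔG , maximal) = inj₁ (ΔG , λ H ΔH → maximal H (inj₁ ΔH))
facet-addFace⁻ (inj₂ G⊆F , maximal) = inj₂ (sym (maximal _ (inj₂ ⊆-refl) G⊆F))

del-addFace-avoiding : v ∉ F → del (addFace Δ F) v ≐ addFace (del Δ v) F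
del-addFace-avoiding v∉F =
  (λ { (inj₁ ΔG , v∉G) → inj₁ (ΔG , v∉G) ; (inj₂ G⊆F , _) → inj₂ G⊆F }) ,
  (λ { (inj₁ (ΔG , v∉G)) → inj₁ ΔG , v∉G ; (inj₂ G⊆F) → inj₂ G⊆F , v∉F ∘ G⊆F })

lk-addFace-avoiding : v ∉ F → lk (addFace Δ F) v ≐ lk Δ v
lk-addFace-avoiding v∉F =
  (λ { (v∉G , inj₁ ΔG+v) → v∉G , ΔG+v
     ; (_ , inj₂ G+v⊆F) → ⊥-elim (v∉F (G+v⊆F x∈p∪⁅x⁆)) }) ,
  (λ (v∉G , ΔG+v) → v∉G , inj₁ ΔG+v)

del-addFace-through : Closed Δ → Δ (F - v) → del (addFace Δ F) v ≐ del Δ v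
del-addFace-through {F = F} closed ΔF-v =
  (λ { (inj₁ ΔG , v∉G) → ΔG , v∉G
     ; (inj₂ G⊆F , v∉G) → closed (F - _) _ ΔF-v (p⊆q∧x∉p⇒p⊆q-x G⊆F v∉G) , v∉G }) ,
  (λ (ΔG , v∉G) → inj₁ ΔG , v∉G)

lk-addFace-through : v ∈ F → lk (addFace Δ F) v ≐ addFace (lk Δ v) (F - v)
lk-addFace-through v∈F =
  (λ { (v∉G , inj₁ ΔG+v) → inj₁ (v∉G , ΔG+v)
     ; (v∉G , inj₂ G+v⊆F) → inj₂ (p⊆q∧x∉p⇒p⊆q-x (G+v⊆F ∘ p⊆p∪q _) v∉G) }) ,
  (λ { (inj₁ (v∉G , ΔG+v)) → v∉G , inj₁ ΔG+v
     ; (inj₂ G⊆F-v) →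
         p⊆q-x⇒x∉p G⊆F-v , inj₂ (p⊆q∧x∈q⇒p∪⁅x⁆⊆q (x∈p-y⇒x∈p ∘ G⊆F-v) v∈F) })

simplex-VD : ∀ {U} → U ⊆ W → Δ ≐ Simplex U → VertexDecomposable W Δ
simplex-VD U⊆W (Δ⊆U , U⊆Δ) = simplex (inj₂ (_ , U⊆W , λ G → mk⇔ Δ⊆U U⊆Δ))

simplex-closed : ∀ {U} → Δ ≐ Simplex U → Closed Δ
simplex-closed (Δ⊆U , U⊆Δ) G H ΔG H⊆G = U⊆Δ (Δ⊆U ΔG ∘ H⊆G)

simplex-facet : ∀ {U} → Δ ≐ Simplex U → Facet Δ U
simplex-facet (Δ⊆U , U⊆Δ) = U⊆Δ ⊆-refl , λ H ΔH U⊆H → ⊆-antisym (Δ⊆U ΔH) U⊆H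

del-avoided : (∀ {G} → Δ G → v ∉ G) → del Δ v ≐ Δ
del-avoided avoids = proj₁ , λ ΔG → ΔG , avoids ΔG

addFace-void : (∀ {G} → ¬ Δ G) → addFace Δ F ≐ Simplex F
addFace-void void = (λ { (inj₁ ΔG) → ⊥-elim (void ΔG) ; (inj₂ G⊆F) → G⊆F }) , inj₂

-- Least missing faces

Missing : Subset n → ℕ → Complex n → Subset n → Set
Missing W k Δ G = G ⊆ W × ∣ G ∣ ≡ k × ¬ Δ G

missing? : ∀ W k → Decidable Δ → Decidable (Missing W k Δ)
missing? W k Δ? G = (G ⊆? W) ×-dec (∣ G ∣ ℕ.≟ k) ×-dec ¬? (Δ? G)

LeastMissing : Permutation′ n → Subset n → ℕ → Complex n → Subset n → Set
LeastMissing π W k Δ F = Missing W k Δ F × (∀ G → Missing W k Δ G → G ≢ F → Dominated π F G)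

ExtensionOrder : Permutation′ n → Subset n → ℕ → Complex n → Set₁
ExtensionOrder π W k Δ = ∀ F → LeastMissing π W k Δ F → VertexDecomposable W (addFace Δ F)

leastMissing-avoiding : ∀ {k} {Φ : Complex n} (π : Permutation′ n) →
  (∀ {G} → v ∉ G → Φ G → Δ G) → (∀ {G} → v ∉ G → Δ G → Φ G) → ∃ (Missing (W - v) k Φ) →
  LeastMissing (moveToTop π v) W k Δ F → v ∉ F × LeastMissing π (W - v) k Φ F
leastMissing-avoiding {v = v} {Δ = Δ} {W = W} {F = F} {k = k} {Φ = Φ} π Φ⊆Δ Δ⊆Φ
  (G₀ , G₀-missing) ((F⊆W , ∣F∣ , F∉Δ) , least) =
  v∉F , (p⊆q∧x∉p⇒p⊆q-x F⊆W v∉F , ∣F∣ , F∉Δ ∘ Φ⊆Δ v∉F) , least′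
  where
  missing⁺ : ∀ {G} → Missing (W - v) k Φ G → Missing W k Δ G
  missing⁺ (G⊆W-v , ∣G∣ , G∉Φ) =
    x∈p-y⇒x∈p ∘ G⊆W-v , ∣G∣ , G∉Φ ∘ Δ⊆Φ (p⊆q-x⇒x∉p G⊆W-v)
  v∉G₀ = p⊆q-x⇒x∉p (proj₁ G₀-missing)
  v∉F : v ∉ F
  v∉F v∈F =
    moveToTop-¬dominated π v∈F v∉G₀ (least G₀ (missing⁺ G₀-missing) λ { refl → v∉G₀ v∈F })
  least′ : ∀ G → Missing (W - v) k Φ G → G ≢ F → Dominated π F G
  least′ G G-missing G≢F =
    dominated-moveToTop⁻ π v∉F (p⊆q-x⇒x∉p (proj₁ G-missing)) (least G (missing⁺ G-missing) G≢F)

leastMissing-through : ∀ {k} (π : Permutation′ n) → v ∈ W →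
  LeastMissing (moveToTop π v) W (suc k) Δ F → v ∈ F → LeastMissing π (W - v) k (lk Δ v) (F - v)
leastMissing-through {v = v} {W = W} {Δ = Δ} {F = F} {k = k} π v∈W ((F⊆W , ∣F∣ , F∉Δ) , least) v∈F =
  (p⊆q⇒p-x⊆q-x F⊆W , suc-injective (trans (1+∣p-x∣≡∣p∣ v∈F) ∣F∣) , F-v∉lk) , least′
  where
  F-v∉lk : ¬ lk Δ v (F - v)
  F-v∉lk (_ , ΔF) = F∉Δ (subst Δ ([p-x]∪⁅x⁆≡p v∈F) ΔF)
  least′ : ∀ G → Missing (W - v) k (lk Δ v) G → G ≢ F - v → Dominated π (F - v) G
  least′ G (G⊆W-v , ∣G∣ , G∉lk) G≢F-v =
    dominated-moveToTop⁻ π (x∉p-x F v) v∉G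
      (subst (Dominated (moveToTop π v) (F - v)) ([p∪⁅x⁆]-x≡p v∉G)
        (dominated-remove (moveToTop π v) v∈F (least (G ∪ ⁅ v ⁆) G+v-missing G+v≢F)))
    where
    v∉G = p⊆q-x⇒x∉p G⊆W-v
    G+v-missing : Missing W (suc k) Δ (G ∪ ⁅ v ⁆)
    G+v-missing = p⊆q∧x∈q⇒p∪⁅x⁆⊆q (x∈p-y⇒x∈p ∘ G⊆W-v) v∈W ,
                  trans (∣p∪⁅x⁆∣≡1+∣p∣ v∉G) (cong suc ∣G∣) , G∉lk ∘ (v∉G ,_)
    G+v≢F : G ∪ ⁅ v ⁆ ≢ F
    G+v≢F G+v≡F = G≢F-v (trans (sym ([p∪⁅x⁆]-x≡p v∉G)) (cong (_- v) G+v≡F))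

FullOver : Subset n → ℕ → Complex n → Set
FullOver W k Δ = ∀ {G} → G ⊆ W → ∣ G ∣ ≡ k → Δ G

nothingMissing⇒full : ∀ {k} → Decidable Δ → ¬ ∃ (Missing W k Δ) → FullOver W k Δ
nothingMissing⇒full Δ? nothingMissing {G} G⊆W ∣G∣ =
  decidable-stable (Δ? G) λ G∉Δ → nothingMissing (G , G⊆W , ∣G∣ , G∉Δ)

full-downward : ∀ {k} → Closed Δ → FullOver W (suc k) Δ → suc k ≤ ∣ W ∣ → FullOver W k Δ
full-downward {W = W} closed full k<∣W∣ {G} G⊆W refl
  with y , y∈W , y∉G ← ∣p∣<∣q∣⇒∃∈q∖p {p = G} {q = W} k<∣W∣ =
  closed (G ∪ ⁅ y ⁆) G (full (p⊆q∧x∈q⇒p∪⁅x⁆⊆q G⊆W y∈W) (∣p∪⁅x⁆∣≡1+∣p∣ y∉G)) (p⊆p∪q _)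

fullOver[W-v]⇒v∈missing : ∀ {k} → FullOver (W - v) k Δ → Missing W k Δ F → v ∈ F
fullOver[W-v]⇒v∈missing {v = v} {F = F} full (F⊆W , ∣F∣ , F∉Δ) =
  decidable-stable (v ∈? F) λ v∉F → F∉Δ (full (p⊆q∧x∉p⇒p⊆q-x F⊆W v∉F) ∣F∣)

-- Extension orders

extensionOrder-del : ∀ {k} {π : Permutation′ n} → v ∈ W → Δ ⁅ v ⁆ →
  VertexDecomposable (W - v) (lk Δ v) → IsShedding Δ v → Decidable Δ → Closed Δ → Pure k Δ →
  ∃ (Missing (W - v) k (del Δ v)) →
  ExtensionOrder π (W - v) k (del Δ v) → ExtensionOrder (moveToTop π v) W k Δ
extensionOrder-del {v = v} {Δ = Δ} {π = π}
  v∈W Δv vdLk shedding-v Δ? closed pure missing extends F leastF =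
  shedding v v∈W (inj₁ Δv)
    (VD-resp-≐ (≐-sym (del-addFace-avoiding v∉F)) (extends F leastF′))
    (VD-resp-≐ (≐-sym (lk-addFace-avoiding {Δ = Δ} v∉F)) vdLk)
    shedding-v′
  where
  ∣F∣ = proj₁ (proj₂ (proj₁ leastF))
  avoiding = leastMissing-avoiding π (λ _ → proj₁) (λ v∉G ΔG → ΔG , v∉G) missing leastF
  v∉F = proj₁ avoiding
  leastF′ = proj₂ avoiding
  shedding-v′ : IsShedding (addFace Δ F) v
  shedding-v′ G facet with facet-addFace⁻ (Facet-resp-≐ (del-addFace-avoiding v∉F) facet)
  ... | inj₁ facet-del = facet-addFace-pure pure ∣F∣ (shedding-v G facet-del)
  ... | inj₂ refl =
    facet-addFace-self λ H ΔH → subst (∣ H ∣ ≤_) (sym ∣F∣) (face-bound Δ? closed pure ΔH)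

extensionOrder-lk : ∀ {k} {π : Permutation′ n} → v ∈ W → Δ ⁅ v ⁆ →
  VertexDecomposable (W - v) (del Δ v) → IsShedding Δ v → IsComplex W Δ → Pure (suc k) Δ →
  ¬ ∃ (Missing (W - v) (suc k) (del Δ v)) →
  ExtensionOrder π (W - v) k (lk Δ v) → ExtensionOrder (moveToTop π v) W (suc k) Δ
extensionOrder-lk {v = v} {W = W} {Δ = Δ} {k = k} {π = π}
  v∈W Δv vdDel shedding-v cx@(_ , closed) pure nothingMissing extends F leastF@(F-missing , _) =
  shedding v v∈W (inj₁ Δv)
    (VD-resp-≐ (≐-sym (del-addFace-through closed ΔF-v)) vdDel)
    (VD-resp-≐ (≐-sym (lk-addFace-through {Δ = Δ} v∈F)) (extends (F - v) leastF′))
    λ G → facet-addFace-pure pure (proj₁ (proj₂ F-missing)) ∘ shedding-v G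
        ∘ Facet-resp-≐ (del-addFace-through closed ΔF-v)
  where
  del? = VD⇒decidable vdDel
  full : FullOver (W - v) (suc k) Δ
  full G⊆W-v ∣G∣ = proj₁ (nothingMissing⇒full del? nothingMissing G⊆W-v ∣G∣)
  v∈F = fullOver[W-v]⇒v∈missing full F-missing
  leastF′ = leastMissing-through π v∈W leastF v∈F
  k<∣W-v∣ : suc k ≤ ∣ W - v ∣
  k<∣W-v∣ =
    let (D , facetD) , size = del-pure del? closed (closed ⁅ v ⁆ ⊥ Δv ⊥⊆) shedding-v pure in
    subst (_≤ ∣ W - v ∣) (size D facetD) (p⊆q⇒∣p∣≤∣q∣ (proj₁ (del-isComplex cx) D (proj₁ facetD)))
  ΔF-v : Δ (F - v)
  ΔF-v = full-downward closed full k<∣W-v∣ (proj₁ (proj₁ leastF′)) (proj₁ (proj₂ (proj₁ leastF′)))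

addFace-simplex-VD : ∀ {k U z} → z ∈ W → U ⊆ W - z → Δ ≐ Simplex U → Decidable Δ → Pure k Δ →
  ¬ ∃ (Missing (W - z) k Δ) → Missing W k Δ F → VertexDecomposable W (addFace Δ F)
addFace-simplex-VD {W = W} {Δ = Δ} {F = F} {k = k} {U = U} {z = z}
  z∈W U⊆W-z Δ≐U Δ? pure nothingMissing F-missing@(F⊆W , ∣F∣ , _) =
  shedding z z∈W (inj₂ ⁅z⁆⊆F)
    (simplex-VD U⊆W-z (≐-trans del≐Δ Δ≐U)) (simplex-VD (p⊆q⇒p-x⊆q-x F⊆W) lk≐F-z)
    λ G → facet-addFace-pure pure ∣F∣ ∘ Facet-resp-≐ del≐Δ
  where
  closed = simplex-closed Δ≐U
  full : FullOver (W - z) k Δ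
  full = nothingMissing⇒full Δ? nothingMissing
  z∈F = fullOver[W-v]⇒v∈missing full F-missing
  ⁅z⁆⊆F : ⁅ z ⁆ ⊆ F
  ⁅z⁆⊆F y∈⁅z⁆ = subst (_∈ F) (sym (x∈⁅y⁆⇒x≡y z y∈⁅z⁆)) z∈F
  ∣F-z∣+1 : suc ∣ F - z ∣ ≡ k
  ∣F-z∣+1 = trans (1+∣p-x∣≡∣p∣ z∈F) ∣F∣
  ∣F-z∣<∣W-z∣ : suc ∣ F - z ∣ ≤ ∣ W - z ∣
  ∣F-z∣<∣W-z∣ = subst (_≤ ∣ W - z ∣) (trans (proj₂ pure U (simplex-facet Δ≐U)) (sym ∣F-z∣+1))
                      (p⊆q⇒∣p∣≤∣q∣ U⊆W-z)
  ΔF-z : Δ (F - z)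
  ΔF-z = full-downward closed (λ G⊆W-z ∣G∣ → full G⊆W-z (trans ∣G∣ ∣F-z∣+1)) ∣F-z∣<∣W-z∣
                       (p⊆q⇒p-x⊆q-x F⊆W) refl
  z∉faces : ∀ {G} → Δ G → z ∉ G
  z∉faces ΔG = p⊆q-x⇒x∉p U⊆W-z ∘ proj₁ Δ≐U ΔG
  del≐Δ : del (addFace Δ F) z ≐ Δ
  del≐Δ = ≐-trans (del-addFace-through closed ΔF-z) (del-avoided z∉faces)
  lk≐F-z : lk (addFace Δ F) z ≐ Simplex (F - z)
  lk≐F-z = ≐-trans (lk-addFace-through {Δ = Δ} z∈F)
                   (addFace-void λ (_ , ΔG+z) → z∉faces ΔG+z x∈p∪⁅x⁆)

extensionOrder-simplex : ∀ {k U} → Acc _⊂_ W → U ⊆ W → Δ ≐ Simplex U → Decidable Δ → Pure k Δ →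
  Σ (Permutation′ n) λ π → ExtensionOrder π W k Δ
extensionOrder-simplex {W = W} {Δ = Δ} {k = k} {U = U} (acc smaller) U⊆W Δ≐U Δ? pure
  with ∃∈q∖p⊎q⊆p U W
... | inj₂ W⊆U = id , λ F ((F⊆W , _ , F∉Δ) , _) → ⊥-elim (F∉Δ (proj₂ Δ≐U (W⊆U ∘ F⊆W)))
... | inj₁ (z , z∈W , z∉U) with anySubset? (missing? (W - z) k Δ?)
...   | no nothingMissing =
  id , λ F leastF →
    addFace-simplex-VD z∈W (p⊆q∧x∉p⇒p⊆q-x U⊆W z∉U) Δ≐U Δ? pure nothingMissing (proj₁ leastF)
...   | yes missing
  with π , extends ← extensionOrder-simplex (smaller (x∈p⇒p-x⊂p z∈W)) (p⊆q∧x∉p⇒p⊆q-x U⊆W z∉U)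
                                            Δ≐U Δ? pure =
  moveToTop π z , λ F leastF → VD-mono x∈p-y⇒x∈p
    (extends F (proj₂ (leastMissing-avoiding π (λ _ ΔG → ΔG) (λ _ ΔG → ΔG) missing leastF)))

extensionOrder : ∀ {k} → VertexDecomposable W Δ → IsComplex W Δ → Pure k Δ →
  Σ (Permutation′ n) λ π → ExtensionOrder π W k Δ
extensionOrder (simplex (inj₁ void)) _ ((G , ΔG , _) , _) = ⊥-elim (void G ΔG)
extensionOrder vd@(simplex (inj₂ (U , U⊆W , Δ⇔U))) _ pure =
  extensionOrder-simplex (⊂-wellFounded _) U⊆W ((λ {G} → to (Δ⇔U G)) , (λ {G} → from (Δ⇔U G)))
                         (VD⇒decidable vd) pure
extensionOrder {k = zero} vd@(shedding v _ Δv _ _ _) (_ , closed) pure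
  with () ← subst (_≤ 0) (∣⁅x⁆∣≡1 v) (face-bound (VD⇒decidable vd) closed pure Δv)
extensionOrder {W = W} {k = suc k} vd@(shedding v v∈W Δv vdDel vdLk shedding-v) cx@(_ , closed) pure
  with anySubset? (missing? (W - v) (suc k) (VD⇒decidable vdDel))
... | yes missing
  with π , extends ← extensionOrder vdDel (del-isComplex cx)
                       (del-pure (VD⇒decidable vdDel) closed (closed ⁅ v ⁆ ⊥ Δv ⊥⊆) shedding-v pure) =
  moveToTop π v , extensionOrder-del v∈W Δv vdLk shedding-v (VD⇒decidable vd) closed pure missing extends
... | no nothingMissing
  with π , extends ← extensionOrder vdLk (lk-isComplex cx) (lk-pure (VD⇒decidable vdLk) closed Δv pure) =
  moveToTop π v , extensionOrder-lk v∈W Δv vdDel shedding-v cx pure nothingMissing extends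

theorem2p9 : (n d : ℕ) (Δ : Complex n) → IsComplex ⊤ Δ → PureOfDim d Δ →
    VertexDecomposable ⊤ Δ →
    Full d Δ ⊎
    (Σ (Permutation′ n) λ π → (F : Subset n) → ∣ F ∣ ≡ suc d → ¬ Δ F →
      ((G : Subset n) → ∣ G ∣ ≡ suc d → ¬ Δ G → ¬ G ≡ F → RevlexLt π F G) →
      VertexDecomposable ⊤ (addFace Δ F))
-- A full Δ has no missing (d+1)-set, so the second alternative then holds vacuously.
theorem2p9 n d Δ cx pure vd with π , extends ← extensionOrder vd cx pure =
  inj₂ (π , λ F ∣F∣ F∉Δ least →
    extends F ((⊆⊤ , ∣F∣ , F∉Δ) ,
               λ G (_ , ∣G∣ , G∉Δ) G≢F → revlex⇒dominated π (least G ∣G∣ G∉Δ G≢F)))
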